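{- Let $S$ be a string of length $n$. For all integers $i\ge 1$ and $k\ge 0$ with $i+k+1\le n$ such that $\mathsf{OC}[i+1..i+k+1]=0^k1$ (i.e., $\mathsf{OC}[i+1]=\cdots=\mathsf{OC}[i+k]=0$ and $\mathsf{OC}[i+k+1]=1$), if $\mathsf{P}[i]\ge k$ then $\mathsf{P}[i]-k\in\mathrm{Bord}[i]$.
   Context: A border of a string $w$ is a string $\beta\neq w$ (possibly empty) that is both a prefix and a suffix of $w$. A string $w$ is closed if $|w|=1$ or $w$ has a nonempty border that occurs in $w$ only as a prefix and as a suffix. For $S=S[1..n]$: $\mathsf{OC}[i]=1$ if $S[1..i]$ is closed and $0$ otherwise; $\mathsf{P}[i]$ is the length of the longest prefix of $S[1..i]$ that has at least two occurrences in $S[1..i]$; $\mathrm{Bord}[i]=\{|\beta| : \beta \text{ is a border of } S[1..i]\}$ (which always contains $0$). -}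

module Defs where

open import Data.Nat using (ℕ; _≤_; _+_)
open import Data.List using (List; []; _++_; length; take)
open import Data.Product using (Σ; ∃; _×_; _,_)
open import Data.Sum using (_⊎_)
open import Relation.Binary.PropositionalEquality using (_≡_; _≢_)

-- Strings over an arbitrary alphabet A are lists; S[1..i] is  take i S.

IsPrefix : {A : Set} → List A → List A → Set
IsPrefix u w = ∃ λ t → w ≡ u ++ t

IsSuffix : {A : Set} → List A → List A → Set
IsSuffix u w = ∃ λ t → w ≡ t ++ u

IsBorder : {A : Set} → List A → List A → Set
IsBorder β w = β ≢ w × IsPrefix β w × IsSuffix β w

Occ : {A : Set} → List A → List A → List A → List A → Set
Occ u w xs ys = w ≡ xs ++ u ++ ys

Closed : {A : Set} → List A → Set
Closed w = length w ≡ 1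
  ⊎ Σ _ λ β → IsBorder β w × β ≢ []
      × (∀ xs ys → Occ β w xs ys → xs ≡ [] ⊎ ys ≡ [])

TwoOcc : {A : Set} → List A → List A → Set
TwoOcc u w = Σ _ λ xs → Σ _ λ ys → Σ _ λ xs' → Σ _ λ ys' →
  Occ u w xs ys × Occ u w xs' ys' × length xs ≢ length xs'

-- P[i] for w = S[1..i]:  p is the length of the longest prefix of w having at
-- least two occurrences in w
IsLongestRepPrefix : {A : Set} → List A → ℕ → Set
IsLongestRepPrefix w p =
  p ≤ length w × TwoOcc (take p w) w × (∀ q → q ≤ length w → TwoOcc (take q w) w → q ≤ p)

OC1 : {A : Set} → List A → ℕ → Set
OC1 S j = Closed (take j S)

InBord : {A : Set} → ℕ → List A → Set
InBord m w = Σ _ λ β → IsBorder β w × length β ≡ m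

module Submission where

-- Write u = S[1..p+1]. By maximality of p = P[i], u occurs at most once in S[1..i], and it cannot
-- acquire a second occurrence in S[1..i+1], ..., S[1..i+k]: the first prefix in which it does is
-- closed, with border u. So the closing border β of S[1..i+k+1] is exactly u: a longer β would
-- make u occur twice in S[1..i+k], while a shorter β, being a prefix of S[1..p], would force
-- S[1..p] to occur only once in S[1..i]. Hence S[1..i+k+1] ends with S[1..p+1], and cutting the
-- last k+1 letters of both shows that S[1..p-k] is a suffix, hence a border, of S[1..i].

open import Defs
open import Data.Nat using (ℕ; zero; suc; _≤_; _<_; _+_; _∸_; s≤s; s≤s⁻¹; z≤n)
open import Data.Nat.Properties
open import Data.List using (List; []; _∷_; _++_; length; take; drop)
open import Data.List.Properties
  using (length-++; length-++-≤ˡ; length-take; take-take; take++drop≡id; ++-assoc; ++-identityʳ)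
open import Data.Product using (Σ; ∃; _×_; _,_)
open import Data.Sum using (_⊎_; inj₁; inj₂)
open import Relation.Nullary using (¬_; contradiction)
open import Relation.Binary.PropositionalEquality

module _ {A : Set} where

  length-take-≤ : ∀ {n} (xs : List A) → n ≤ length xs → length (take n xs) ≡ n
  length-take-≤ {n} xs n≤ = trans (length-take n xs) (m≤n⇒m⊓n≡m n≤)

  take-take-≤ : ∀ {m n} (xs : List A) → m ≤ n → take m (take n xs) ≡ take m xs
  take-take-≤ {m} {n} xs m≤n =
    trans (take-take m n xs) (cong (λ j → take j xs) (m≤n⇒m⊓n≡m m≤n))

  take-++ˡ : ∀ n (xs ys : List A) → length xs ≤ n →
    take n (xs ++ ys) ≡ xs ++ take (n ∸ length xs) ys
  take-++ˡ n       []       ys _         = refl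
  take-++ˡ (suc n) (x ∷ xs) ys (s≤s le) = cong (x ∷_) (take-++ˡ n xs ys le)

  take-length-++ : (xs ys : List A) → take (length xs) (xs ++ ys) ≡ xs
  take-length-++ []       ys = refl
  take-length-++ (x ∷ xs) ys = cong (x ∷_) (take-length-++ xs ys)

  IsPrefix-trans : ∀ {u v w : List A} → IsPrefix u v → IsPrefix v w → IsPrefix u w
  IsPrefix-trans {u} (r , refl) (s , refl) = r ++ s , ++-assoc u r s

  IsPrefix⇒≡take : ∀ {u w : List A} → IsPrefix u w → u ≡ take (length u) w
  IsPrefix⇒≡take {u} (r , refl) = sym (take-length-++ u r)

  take-isPrefix : ∀ {m n} (xs : List A) → m ≤ n → IsPrefix (take m xs) (take n xs)
  take-isPrefix {m} {n} xs m≤n = drop m (take n xs) , (begin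
    take n xs                                 ≡⟨ take++drop≡id m (take n xs) ⟨
    take m (take n xs) ++ drop m (take n xs)  ≡⟨ cong (_++ drop m (take n xs)) (take-take-≤ xs m≤n) ⟩
    take m xs ++ drop m (take n xs)           ∎)
    where open ≡-Reasoning

  take-<-extends : ∀ {m n} (xs : List A) → m < n → n ≤ length xs →
    ∃ λ y → ∃ λ r → take n xs ≡ take m xs ++ y ∷ r
  take-<-extends {m} {n} xs m<n n≤ with take-isPrefix xs (<⇒≤ m<n)
  ... | y ∷ r , eq = y , r , eq
  ... | []    , eq = contradiction (begin
    n                          ≡⟨ length-take-≤ xs n≤ ⟨
    length (take n xs)         ≡⟨ cong length eq ⟩
    length (take m xs ++ [])   ≡⟨ cong length (++-identityʳ (take m xs)) ⟩
    length (take m xs)         ≡⟨ length-take-≤ xs (≤-trans (<⇒≤ m<n) n≤) ⟩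
    m                          ∎) (>⇒≢ m<n)
    where open ≡-Reasoning

  Occ-length : ∀ {u w xs ys : List A} → Occ u w xs ys →
    length w ≡ length xs + (length u + length ys)
  Occ-length {u} {xs = xs} refl = trans (length-++ xs) (cong (length xs +_) (length-++ u))

  Occ-++ʳ : ∀ {u w xs ys : List A} r → Occ u w xs ys → Occ u (w ++ r) xs (ys ++ r)
  Occ-++ʳ {u} {xs = xs} {ys} r refl =
    trans (++-assoc xs (u ++ ys) r) (cong (xs ++_) (++-assoc u ys r))

  Occ-++⁻ : ∀ {u s w xs ys : List A} → Occ (u ++ s) w xs ys → Occ u w xs (s ++ ys)
  Occ-++⁻ {u} {s} {xs = xs} {ys} refl = cong (xs ++_) (++-assoc u s ys)

  Occ-take : ∀ {u w xs ys : List A} m → length xs + length u ≤ m → Occ u w xs ys →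
    Occ u (take m w) xs (take (m ∸ (length xs + length u)) ys)
  Occ-take {u} {xs = xs} {ys} m fits refl = begin
    take m (xs ++ u ++ ys)                                   ≡⟨ take-++ˡ m xs _ (≤-trans (m≤m+n _ _) fits) ⟩
    xs ++ take (m ∸ length xs) (u ++ ys)                     ≡⟨ cong (xs ++_) (take-++ˡ _ u ys u-fits) ⟩
    xs ++ u ++ take (m ∸ length xs ∸ length u) ys            ≡⟨ cong (λ j → xs ++ u ++ take j ys) (∸-+-assoc m (length xs) (length u)) ⟩
    xs ++ u ++ take (m ∸ (length xs + length u)) ys          ∎
    where
    open ≡-Reasoning
    u-fits : length u ≤ m ∸ length xs
    u-fits = subst (_≤ m ∸ length xs) (m+n∸m≡n (length xs) (length u)) (∸-monoˡ-≤ (length xs) fits)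

  Occ-init : ∀ {u v w : List A} → IsPrefix v w → length w ≡ suc (length v) →
    ∀ xs y ys → Occ u w xs (y ∷ ys) → ∃ λ c → Occ u v xs c
  Occ-init {u} {v} (r , refl) len xs y ys o =
    c , subst (λ z → Occ u z xs c) (take-length-++ v r) (Occ-take {u} {xs = xs} (length v) fits o)
    where
    open ≤-Reasoning
    c : List A
    c = take (length v ∸ (length xs + length u)) (y ∷ ys)
    fits : length xs + length u ≤ length v
    fits = s≤s⁻¹ (begin
      suc (length xs + length u)                ≡⟨ +-suc (length xs) (length u) ⟨
      length xs + suc (length u)                ≤⟨ +-monoʳ-≤ (length xs) (s≤s (m≤m+n (length u) (length ys))) ⟩
      length xs + (suc (length u) + length ys)  ≡⟨ cong (length xs +_) (+-suc (length u) (length ys)) ⟨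
      length xs + (length u + suc (length ys))  ≡⟨ Occ-length {u} {xs = xs} {ys = y ∷ ys} o ⟨
      length (v ++ r)                           ≡⟨ len ⟩
      suc (length v)                            ∎)

  Occ-later⇒< : ∀ {u w : List A} x xs ys → Occ u w (x ∷ xs) ys → length u < length w
  Occ-later⇒< {u} x xs ys o = subst (length u <_) (sym (Occ-length {u} {xs = x ∷ xs} {ys} o))
    (s≤s (≤-trans (m≤m+n (length u) (length ys)) (m≤n+m _ (length xs))))

  TwoOcc⇒< : ∀ {u w : List A} → TwoOcc u w → length u < length w
  TwoOcc⇒< ([]     , _  , []     , _   , _ , _  , ne) = contradiction refl ne
  TwoOcc⇒< (x ∷ xs , ys , _      , _   , o , _  , _)  = Occ-later⇒< x xs ys o
  TwoOcc⇒< ([]     , _  , x ∷ xs , ys′ , _ , o′ , _)  = Occ-later⇒< x xs ys′ o′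

  prefix-and-later⇒TwoOcc : ∀ {u w : List A} x xs ys → IsPrefix u w → Occ u w (x ∷ xs) ys → TwoOcc u w
  prefix-and-later⇒TwoOcc x xs ys (r , eq) o = [] , r , x ∷ xs , ys , eq , o , λ ()

  ClosingBorder : List A → List A → Set
  ClosingBorder β w = IsBorder β w × β ≢ [] × (∀ xs ys → Occ β w xs ys → xs ≡ [] ⊎ ys ≡ [])

  second-occurrence⇒ClosingBorder : ∀ {u v w : List A} → IsPrefix v w → length w ≡ suc (length v) →
    u ≢ [] → IsPrefix u v → ¬ TwoOcc u v → TwoOcc u w → ClosingBorder u w
  second-occurrence⇒ClosingBorder {u} {v} {w} v⊑w len u≢[] u⊑v once twice =
    (u≢w , IsPrefix-trans u⊑v v⊑w , suffix twice) , u≢[] , only-ends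
    where
    u≢w : u ≢ w
    u≢w eq = <⇒≢ (TwoOcc⇒< twice) (cong length eq)
    inside : ∀ xs y ys → Occ u w xs (y ∷ ys) → ∃ λ c → Occ u v xs c
    inside = Occ-init v⊑w len
    suffix : TwoOcc u w → IsSuffix u w
    suffix (xs , [] , _ , _ , o , _ , _)       = xs , trans o (cong (xs ++_) (++-identityʳ u))
    suffix (_ , _ ∷ _ , xs′ , [] , _ , o′ , _) = xs′ , trans o′ (cong (xs′ ++_) (++-identityʳ u))
    suffix (xs , y ∷ ys , xs′ , y′ ∷ ys′ , o , o′ , ne)
      with inside xs y ys o | inside xs′ y′ ys′ o′
    ... | c , p | c′ , p′ = contradiction (xs , c , xs′ , c′ , p , p′ , ne) once
    only-ends : ∀ xs ys → Occ u w xs ys → xs ≡ [] ⊎ ys ≡ []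
    only-ends []       _        _ = inj₁ refl
    only-ends (_ ∷ _)  []       _ = inj₂ refl
    only-ends (x ∷ xs) (y ∷ ys) o with inside (x ∷ xs) y ys o
    ... | c , o′ = contradiction (prefix-and-later⇒TwoOcc x xs c u⊑v o′) once

  border-proper-prefix⇒TwoOcc : ∀ {β u v w r : List A} {y} → IsBorder β w → IsPrefix v w →
    length w ≡ suc (length v) → β ≡ u ++ y ∷ r → TwoOcc u v
  border-proper-prefix⇒TwoOcc (β≢w , _ , [] , w≡β) _ _ _ = contradiction (sym w≡β) β≢w
  border-proper-prefix⇒TwoOcc {u = u} {r = r} {y} (_ , (s , w≡βs) , x ∷ l , w≡lβ) v⊑w len refl
    with Occ-init {u} v⊑w len [] y (r ++ s) (trans w≡βs (++-assoc u (y ∷ r) s))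
       | Occ-init {u} v⊑w len (x ∷ l) y r w≡lβ
  ... | c , o | c′ , o′ = [] , c , x ∷ l , c′ , o , o′ , λ ()

  closingBorder-extension-occurs-once : ∀ {β u v w : List A} → ClosingBorder β w → IsPrefix v w →
    length v < length w → IsPrefix β u → ¬ TwoOcc u v
  closingBorder-extension-occurs-once {β} {v = v} (_ , _ , only-ends) (r , refl) v<w (s , refl)
    (xs , ys , xs′ , ys′ , o , o′ , ne) = ne (cong length (trans (at-start xs ys o) (sym (at-start xs′ ys′ o′))))
    where
    border-occ : ∀ xs ys → Occ (β ++ s) v xs ys → Occ β (v ++ r) xs (s ++ ys ++ r)
    border-occ xs ys o = Occ-++⁻ {β} {s} {xs = xs} {ys ++ r} (Occ-++ʳ {β ++ s} {xs = xs} {ys} r o)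
    at-start : ∀ xs ys → Occ (β ++ s) v xs ys → xs ≡ []
    at-start xs ys o with only-ends xs (s ++ ys ++ r) (border-occ xs ys o)
    ... | inj₁ xs≡[]   = xs≡[]
    ... | inj₂ tail≡[] = contradiction w≤v (<⇒≱ v<w)
      where
      open ≤-Reasoning
      w≤v : length (v ++ r) ≤ length v
      w≤v = begin
        length (v ++ r)                                  ≡⟨ Occ-length {β} {xs = xs} {s ++ ys ++ r} (border-occ xs ys o) ⟩
        length xs + (length β + length (s ++ ys ++ r))   ≡⟨ cong (λ t → length xs + (length β + length t)) tail≡[] ⟩
        length xs + (length β + 0)                       ≤⟨ +-monoʳ-≤ (length xs) (+-mono-≤ (length-++-≤ˡ β) z≤n) ⟩
        length xs + (length (β ++ s) + length ys)        ≡⟨ Occ-length {β ++ s} {xs = xs} {ys} o ⟨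
        length v                                         ∎

  Closed⇒ClosingBorder : ∀ {w : List A} → Closed w → 1 < length w → Σ (List A) λ β → ClosingBorder β w
  Closed⇒ClosingBorder (inj₁ ∣w∣≡1) 1<∣w∣ = contradiction ∣w∣≡1 (>⇒≢ 1<∣w∣)
  Closed⇒ClosingBorder (inj₂ closing) _  = closing

  take-suc-≢[] : ∀ {n} (xs : List A) → suc n ≤ length xs → take (suc n) xs ≢ []
  take-suc-≢[] (_ ∷ _) _ ()

  length-take-suc : ∀ {n} (xs : List A) → suc n ≤ length xs →
    length (take (suc n) xs) ≡ suc (length (take n xs))
  length-take-suc xs n<∣xs∣ =
    trans (length-take-≤ xs n<∣xs∣) (cong suc (sym (length-take-≤ xs (<⇒≤ n<∣xs∣))))

  longestRepPrefix-repeats : ∀ (S : List A) {i p} → i ≤ length S →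
    IsLongestRepPrefix (take i S) p → TwoOcc (take p S) (take i S)
  longestRepPrefix-repeats S i≤∣S∣ (p≤ , repeats , _) =
    subst (λ u → TwoOcc u (take _ S)) (take-take-≤ S (subst (_ ≤_) (length-take-≤ S i≤∣S∣) p≤)) repeats

  longestRepPrefix-< : ∀ (S : List A) {i p} → i ≤ length S → IsLongestRepPrefix (take i S) p → p < i
  longestRepPrefix-< S {p = p} i≤∣S∣ longest@(p≤ , _ , _) = subst₂ _<_
    (length-take-≤ S (≤-trans (subst (p ≤_) (length-take-≤ S i≤∣S∣) p≤) i≤∣S∣))
    (length-take-≤ S i≤∣S∣)
    (TwoOcc⇒< (longestRepPrefix-repeats S i≤∣S∣ longest))

  longestRepPrefix-maximal : ∀ (S : List A) {i p} → i ≤ length S →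
    IsLongestRepPrefix (take i S) p → ¬ TwoOcc (take (suc p) S) (take i S)
  longestRepPrefix-maximal S {i} {p} i≤∣S∣ longest@(_ , _ , maximal) twice =
    1+n≰n (maximal (suc p) sp≤∣Si∣ (subst (λ u → TwoOcc u (take i S)) (sym (take-take-≤ S sp≤i)) twice))
    where
    sp≤i : suc p ≤ i
    sp≤i = longestRepPrefix-< S i≤∣S∣ longest
    sp≤∣Si∣ : suc p ≤ length (take i S)
    sp≤∣Si∣ = subst (suc p ≤_) (sym (length-take-≤ S i≤∣S∣)) sp≤i

  occurs-once-while-not-closed : ∀ (S : List A) {u} i k → i + k ≤ length S → u ≢ [] →
    IsPrefix u (take i S) → (∀ j → i + 1 ≤ j → j ≤ i + k → ¬ OC1 S j) →
    ¬ TwoOcc u (take i S) → ¬ TwoOcc u (take (i + k) S)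
  occurs-once-while-not-closed S {u} i zero _ _ _ _ once =
    subst (λ n → ¬ TwoOcc u (take n S)) (sym (+-identityʳ i)) once
  occurs-once-while-not-closed S {u} i (suc k) i+k+1≤∣S∣ u≢[] u⊑Si not-closed once twice =
    not-closed (i + suc k) (+-monoʳ-≤ i (s≤s z≤n)) ≤-refl (inj₂ (u , closing))
    where
    i+k≤i+k+1 : i + k ≤ i + suc k
    i+k≤i+k+1 = +-monoʳ-≤ i (n≤1+n k)
    still-once : ¬ TwoOcc u (take (i + k) S)
    still-once = occurs-once-while-not-closed S i k (≤-trans i+k≤i+k+1 i+k+1≤∣S∣) u≢[] u⊑Si
      (λ j i<j j≤i+k → not-closed j i<j (≤-trans j≤i+k i+k≤i+k+1)) once
    closing : ClosingBorder u (take (i + suc k) S)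
    closing = second-occurrence⇒ClosingBorder
      (take-isPrefix S i+k≤i+k+1)
      (trans (length-take-≤ S i+k+1≤∣S∣)
        (trans (+-suc i k) (cong suc (sym (length-take-≤ S (≤-trans i+k≤i+k+1 i+k+1≤∣S∣))))))
      u≢[] (IsPrefix-trans u⊑Si (take-isPrefix S (m≤m+n i k))) still-once twice

  closingBorder-≡-take : ∀ (S : List A) {β t p i} → suc t ≤ length S → i ≤ t →
    ClosingBorder β (take (suc t) S) → ¬ TwoOcc (take (suc p) S) (take t S) →
    TwoOcc (take p S) (take i S) → β ≡ take (suc p) S
  closingBorder-≡-take S {β} {t} {p} st≤∣S∣ i≤t closing@(border@(_ , β⊑w@(s , w≡βs) , _) , _) once repeats =
    trans β≡take (cong (λ n → take n S) (≤-antisym b≤sp sp≤b))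
    where
    b : ℕ
    b = length β
    b≤st : b ≤ suc t
    b≤st = subst (b ≤_) (trans (cong length (sym w≡βs)) (length-take-≤ S st≤∣S∣)) (length-++-≤ˡ β)
    β≡take : β ≡ take b S
    β≡take = trans (IsPrefix⇒≡take β⊑w) (take-take-≤ S b≤st)
    b≤sp : b ≤ suc p
    b≤sp = ≮⇒≥ λ sp<b → let (y , r , extends) = take-<-extends S sp<b (≤-trans b≤st st≤∣S∣) in
      once (border-proper-prefix⇒TwoOcc border (take-isPrefix S (n≤1+n t)) (length-take-suc S st≤∣S∣)
        (trans β≡take extends))
    sp≤b : suc p ≤ b
    sp≤b = ≰⇒> λ b≤p → closingBorder-extension-occurs-once closing
      (take-isPrefix S (≤-trans i≤t (n≤1+n t)))
      (subst₂ _<_ (sym (length-take-≤ S (≤-trans (≤-trans i≤t (n≤1+n t)) st≤∣S∣))) (sym (length-take-≤ S st≤∣S∣)) (s≤s i≤t))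
      (subst (λ u → IsPrefix u (take p S)) (sym β≡take) (take-isPrefix S b≤p))
      repeats

  take-suffix-shorten : ∀ (S : List A) {m d q} → m + d ≤ length S → q ≤ length S → d ≤ q →
    IsSuffix (take q S) (take (m + d) S) → IsSuffix (take (q ∸ d) S) (take m S)
  take-suffix-shorten S {m} {d} {q} m+d≤∣S∣ q≤∣S∣ d≤q (l , eq) = l , (begin
    take m S                             ≡⟨ take-take-≤ S (m≤m+n m d) ⟨
    take m (take (m + d) S)              ≡⟨ cong (take m) eq ⟩
    take m (l ++ take q S)               ≡⟨ take-++ˡ m l (take q S) ∣l∣≤m ⟩
    l ++ take (m ∸ length l) (take q S)  ≡⟨ cong (λ n → l ++ take n (take q S)) shift ⟩
    l ++ take (q ∸ d) (take q S)         ≡⟨ cong (l ++_) (take-take-≤ S (m∸n≤m q d)) ⟩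
    l ++ take (q ∸ d) S                  ∎)
    where
    open ≡-Reasoning
    ∣l∣+q≡m+d : length l + q ≡ m + d
    ∣l∣+q≡m+d = begin
      length l + q                  ≡⟨ cong (length l +_) (length-take-≤ S q≤∣S∣) ⟨
      length l + length (take q S)  ≡⟨ length-++ l ⟨
      length (l ++ take q S)        ≡⟨ cong length eq ⟨
      length (take (m + d) S)       ≡⟨ length-take-≤ S m+d≤∣S∣ ⟩
      m + d                         ∎
    ∣l∣≤m : length l ≤ m
    ∣l∣≤m = +-cancelʳ-≤ d (length l) m (≤-trans (+-monoʳ-≤ (length l) d≤q) (≤-reflexive ∣l∣+q≡m+d))
    shift : m ∸ length l ≡ q ∸ d
    shift = begin
      m ∸ length l                   ≡⟨ [m+n]∸[m+o]≡n∸o d m (length l) ⟨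
      (d + m) ∸ (d + length l)       ≡⟨ cong₂ _∸_ (trans (+-comm d m) (sym ∣l∣+q≡m+d)) (+-comm d (length l)) ⟩
      (length l + q) ∸ (length l + d) ≡⟨ [m+n]∸[m+o]≡n∸o (length l) q d ⟩
      q ∸ d                          ∎

  prefix-suffix⇒InBord : ∀ (S : List A) {m n} → m < n → n ≤ length S →
    IsSuffix (take m S) (take n S) → InBord m (take n S)
  prefix-suffix⇒InBord S {m} {n} m<n n≤∣S∣ suffix =
    take m S , (shorter , take-isPrefix S (<⇒≤ m<n) , suffix) , ∣take-m∣≡m
    where
    ∣take-m∣≡m : length (take m S) ≡ m
    ∣take-m∣≡m = length-take-≤ S (≤-trans (<⇒≤ m<n) n≤∣S∣)
    shorter : take m S ≢ take n S
    shorter eq = <⇒≢ m<n (trans (sym ∣take-m∣≡m) (trans (cong length eq) (length-take-≤ S n≤∣S∣)))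

lemma4 : {A : Set} (S : List A) (i k p : ℕ) →
    1 ≤ i → i + k + 1 ≤ length S →
    (∀ j → i + 1 ≤ j → j ≤ i + k → ¬ OC1 S j) →
    OC1 S (i + k + 1) →
    IsLongestRepPrefix (take i S) p →
    k ≤ p →
    InBord (p ∸ k) (take i S)
lemma4 {A} S i k p 1≤i i+k+1≤∣S∣ not-closed closed longest k≤p =
  prefix-suffix⇒InBord S (≤-<-trans (m∸n≤m p k) p<i) i≤∣S∣
    (take-suffix-shorten S (subst (_≤ length S) (sym (+-suc i k)) st≤∣S∣) sp≤∣S∣ (s≤s k≤p)
      (subst (λ n → IsSuffix (take (suc p) S) (take n S)) (sym (+-suc i k))
        (border-is-P+1-prefix (Closed⇒ClosingBorder (subst (OC1 S) (+-comm (i + k) 1) closed) 1<∣w∣))))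
  where
  st≤∣S∣ : suc (i + k) ≤ length S
  st≤∣S∣ = subst (_≤ length S) (+-comm (i + k) 1) i+k+1≤∣S∣
  i≤∣S∣ : i ≤ length S
  i≤∣S∣ = ≤-trans (m≤m+n i k) (<⇒≤ st≤∣S∣)
  p<i : p < i
  p<i = longestRepPrefix-< S i≤∣S∣ longest
  sp≤∣S∣ : suc p ≤ length S
  sp≤∣S∣ = ≤-trans p<i i≤∣S∣
  1<∣w∣ : 1 < length (take (suc (i + k)) S)
  1<∣w∣ = subst (1 <_) (sym (length-take-≤ S st≤∣S∣)) (s≤s (≤-trans 1≤i (m≤m+n i k)))
  once : ¬ TwoOcc (take (suc p) S) (take (i + k) S)
  once = occurs-once-while-not-closed S i k (<⇒≤ st≤∣S∣) (take-suc-≢[] S sp≤∣S∣) (take-isPrefix S p<i)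
    not-closed (longestRepPrefix-maximal S i≤∣S∣ longest)
  border-is-P+1-prefix : (Σ (List A) λ β → ClosingBorder β (take (suc (i + k)) S)) →
    IsSuffix (take (suc p) S) (take (suc (i + k)) S)
  border-is-P+1-prefix (β , closing@((_ , _ , β-suffix) , _)) =
    subst (λ u → IsSuffix u (take (suc (i + k)) S))
      (closingBorder-≡-take S st≤∣S∣ (m≤m+n i k) closing once (longestRepPrefix-repeats S i≤∣S∣ longest))
      β-suffix
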